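{- Let $\mathcal H\subseteq 2^V$ be a JM hypergraph, let $H,H'\in\mathcal H$ with $H\cap H'=\emptyset$, and let $S$ be a set with $H\subseteq S\subseteq V\setminus H'$. Then $\mathcal H^+=\mathcal H\cup\{S\}$ is also a JM hypergraph, and $\mathcal G_{\mathcal H^+}=\mathcal G_{\mathcal H}$.
   Context: Let $V=\{1,\dots,n\}$. A hypergraph is a family $\mathcal H\subseteq 2^V$ with $\mathcal H\neq\emptyset$, $\emptyset\notin\mathcal H$, $V=\bigcup_{H\in\mathcal H}H$. The game $NIM_{\mathcal H}$ is played on positions $x\in\mathbb{Z}_{\ge 0}^V$; a move ($H$-move) $x\to x'$ chooses $H\in\mathcal H$ and goes to any $x'\in\mathbb Z_{\ge0}^V$ with $x'_i<x_i$ for $i\in H$ and $x'_i=x_i$ for $i\notin H$. Players alternate; the player who cannot move loses. The Sprague–Grundy function is $\mathcal G_{\mathcal H}(x)=\mathrm{mex}\{\mathcal G_{\mathcal H}(x') : x\to x' \text{ a move}\}$ ($\mathrm{mex}(S)$ = least nonnegative integer not in $S$). The height $h_{\mathcal H}(x)$ is the maximum number of consecutive moves possible from $x$. With $e$ the all-ones vector, $m(x)=\min_{i}x_i$, $y_{\mathcal H}(x)=h_{\mathcal H}(x-m(x)e)+1$, $v_{\mathcal H}(x)=\binom{y_{\mathcal H}(x)}{2}+\big((m(x)-\binom{y_{\mathcal H}(x)}{2}-1)\bmod y_{\mathcal H}(x)\big)$ (residue in $\{0,\dots,y_{\mathcal H}(x)-1\}$), and $f_{\mathcal H}(x)=h_{\mathcal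 H}(x)$ if $m(x)\le\binom{y_{\mathcal H}(x)}{2}$, else $f_{\mathcal H}(x)=v_{\mathcal H}(x)$. $\mathcal H$ is JM if $\mathcal G_{\mathcal H}=f_{\mathcal H}$ on $\mathbb Z_{\ge0}^V$. -}

module Defs where

open import Data.Bool using (Bool; true; false; if_then_else_)
open import Data.Nat using (ℕ; zero; suc; _+_; _∸_; _⊔_; _⊓_; _≤ᵇ_; _%_)
open import Data.Nat.Combinatorics using (_C_)
open import Data.Fin using (Fin)
open import Data.Vec using (Vec; []; _∷_)
import Data.Vec as Vec
open import Data.List using (List; []; _∷_; map; concatMap; upTo; length; foldr)
open import Data.List.Relation.Unary.All using (All)
open import Data.List.Relation.Unary.Any using (Any)
open import Data.List.Membership.DecPropositional Data.Nat._≟_ using (_∈?_)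
open import Data.Fin.Subset using (Subset; Nonempty) renaming (_∈_ to _∈ₛ_)
open import Relation.Nullary using (¬_; does)
open import Relation.Binary.PropositionalEquality using (_≡_)
open import Data.Product using (_×_)

-- Vertex set V = Fin n, a position is a vector x ∈ ℕ^V, an edge is a subset of V.
Position : ℕ → Set
Position n = Vec ℕ n

Family : ℕ → Set
Family n = List (Subset n)

IsHypergraph : ∀ {n} → Family n → Set
IsHypergraph {n} ℋ = ¬ (ℋ ≡ []) × All Nonempty ℋ × (∀ (i : Fin n) → Any (i ∈ₛ_) ℋ)

-- All positions reachable from x by one H-move:
-- x'_i < x_i for i ∈ H, x'_i = x_i for i ∉ H.
edgeMoves : ∀ {n} → Subset n → Position n → List (Position n)
edgeMoves [] [] = [] ∷ []
edgeMoves (true ∷ H) (a ∷ x) = concatMap (λ b → map (b ∷_) (edgeMoves H x)) (upTo a)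
edgeMoves (false ∷ H) (a ∷ x) = map (a ∷_) (edgeMoves H x)

options : ∀ {n} → Family n → Position n → List (Position n)
options ℋ x = concatMap (λ H → edgeMoves H x) ℋ

-- mex of a finite list: least k not in the list (it is ≤ length l).
mexAux : ℕ → ℕ → List ℕ → ℕ
mexAux zero k l = k
mexAux (suc f) k l = if does (k ∈? l) then mexAux f (suc k) l else k

mex : List ℕ → ℕ
mex l = mexAux (suc (length l)) 0 l

sumV : ∀ {n} → Position n → ℕ
sumV = Vec.foldr _ _+_ 0

-- Sprague–Grundy function, by recursion with fuel; fuel sumV x + 1 suffices
-- since every move (edges nonempty) strictly decreases the coordinate sum.
grundyF : ∀ {n} → ℕ → Family n → Position n → ℕ
grundyF zero ℋ x = 0
grundyF (suc k) ℋ x = mex (map (grundyF k ℋ) (options ℋ x))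

grundy : ∀ {n} → Family n → Position n → ℕ
grundy ℋ x = grundyF (suc (sumV x)) ℋ x

heightF : ∀ {n} → ℕ → Family n → Position n → ℕ
heightF zero ℋ x = 0
heightF (suc k) ℋ x = foldr _⊔_ 0 (map (λ x' → suc (heightF k ℋ x')) (options ℋ x))

height : ∀ {n} → Family n → Position n → ℕ
height ℋ x = heightF (suc (sumV x)) ℋ x

-- m(x) = min_i x_i (value 0 on the empty vector, which never occurs for hypergraphs).
minV : ∀ {n} → Position n → ℕ
minV [] = 0
minV (a ∷ []) = a
minV (a ∷ b ∷ x) = a ⊓ minV (b ∷ x)

yH : ∀ {n} → Family n → Position n → ℕ
yH ℋ x = suc (height ℋ (Vec.map (_∸ minV x) x))

-- v(x) = C(y,2) + ((m - C(y,2) - 1) mod y); only used when m > C(y,2).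
vH : ∀ {n} → Family n → Position n → ℕ
vH ℋ x = (yH ℋ x C 2) + ((minV x ∸ (yH ℋ x C 2) ∸ 1) % yH ℋ x)

fH : ∀ {n} → Family n → Position n → ℕ
fH ℋ x = if minV x ≤ᵇ (yH ℋ x C 2) then height ℋ x else vH ℋ x

JM : ∀ {n} → Family n → Set
JM ℋ = IsHypergraph ℋ × (∀ x → grundy ℋ x ≡ fH ℋ x)

module Submission where

-- Theorem 3.7: if ℋ is JM, H, H' ∈ ℋ and H ⊆ S ⊆ V ∖ H', then ℋ⁺ = S ∷ ℋ is
-- JM and has the same Sprague–Grundy function as ℋ.
--
-- Both equalities are proved by strong induction on the coordinate sum.
-- * Heights: an S-move x → x' is dominated coordinatewise by an H-move x → u,
--   and height is monotone, so h_ℋ(x') < h_ℋ(x).  Hence h_{ℋ⁺} = h_ℋ, and as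
--   f is computed from heights alone, f_{ℋ⁺} = f_ℋ.
-- * Grundy values: the options of x in NIM_{ℋ⁺} are its S-moves followed by
--   its ℋ-moves, so by the mex lemma it suffices that no S-move x → x' has
--   𝒢_ℋ(x') = 𝒢_ℋ(x).  Since 𝒢_ℋ = f_ℋ, this is an arithmetic property of the
--   formula for f, given five inequalities between m, h and h(x - m e) at x
--   and x'; the lower bounds come from H' ∈ ℋ, on which S-moves act trivially.

open import Defs
open import Level using (0ℓ)
open import Function using (_∘_)
open import Data.Bool using (true; false; T; if_then_else_)
open import Data.Unit using (⊤; tt)
open import Data.Nat
open import Data.Nat.Properties
open import Data.Nat.DivMod
open import Data.Nat.Combinatorics using (_C_; nC1≡n; nCk+nC[k+1]≡[n+1]C[k+1])
open import Data.Nat.Induction using (<-wellFounded)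
open import Data.Fin using (Fin; toℕ)
open import Data.Fin.Properties using (pigeonhole; toℕ<n; toℕ-injective)
import Data.Fin.Properties as Fin
open import Data.Fin.Subset using (Subset; Nonempty; _⊆_; _∩_; ⊥; ∁)
open import Data.Fin.Subset.Properties using (drop-∷-⊆)
open import Data.Vec using ([]; _∷_)
import Data.Vec as Vec
open import Data.Vec.Relation.Binary.Pointwise.Inductive using (Pointwise; []; _∷_)
open import Data.Vec.Relation.Unary.All as AllV using ([]; _∷_) renaming (All to AllV)
open import Data.Vec.Base using (here; there)
open import Data.List using (List; []; _∷_; map; foldr; upTo; length; lookup; _++_)
open import Data.List.Properties using (map-++; map-cong-local)
open import Data.List.Relation.Unary.All as All using (All; _∷_)
open import Data.List.Relation.Unary.Any as Any using (index)
open import Data.List.Relation.Unary.Any.Properties using (lookup-index)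
open import Data.List.Membership.Propositional using (_∈_; _∉_)
open import Data.List.Membership.Propositional.Properties
open import Data.List.Membership.DecPropositional Data.Nat._≟_ using (_∈?_)
open import Data.Product using (_×_; _,_; proj₁; proj₂; ∃)
open import Data.Sum using (_⊎_; inj₁; inj₂; [_,_])
import Data.Sum as Sum
open import Induction.WellFounded as WF using ()
import Relation.Binary.Construct.On as On
open import Relation.Binary using (tri<; tri≈; tri>)
open import Relation.Nullary using (yes; no; contradiction)
open import Relation.Binary.PropositionalEquality hiding ([_])

IsMex : List ℕ → ℕ → Set
IsMex l m = m ∉ l × (∀ {j} → j < m → j ∈ l)

all-below⇒≤length : ∀ l k → (∀ {j} → j < k → j ∈ l) → k ≤ length l
all-below⇒≤length l k below with k ≤? length l
... | yes k≤len = k≤len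
... | no k≰len =
  let i , j , i<j , same = pigeonhole (≰⇒> k≰len) position
  in contradiction (toℕ-injective (trans (at i) (trans (cong (lookup l) same) (sym (at j)))))
                   (Fin.<⇒≢ i<j)
  where
  position : Fin k → Fin (length l)
  position i = index (below (toℕ<n i))

  at : ∀ i → toℕ i ≡ lookup l (position i)
  at i = lookup-index (below (toℕ<n i))

mexAux-spec : ∀ l fuel k → (∀ {j} → j < k → j ∈ l) →
  (∀ {j} → j < mexAux fuel k l → j ∈ l) × (mexAux fuel k l ∉ l ⊎ mexAux fuel k l ≡ k + fuel)
mexAux-spec l zero k below = below , inj₂ (sym (+-identityʳ k))
mexAux-spec l (suc fuel) k below with k ∈? l
... | no k∉l = below , inj₁ k∉l
... | yes k∈l =
  let below′ , stop = mexAux-spec l fuel (suc k) below-suc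
  in below′ , Sum.map₂ (λ e → trans e (sym (+-suc k fuel))) stop
  where
  below-suc : ∀ {j} → j < suc k → j ∈ l
  below-suc j<1+k with m<1+n⇒m<n∨m≡n j<1+k
  ... | inj₁ j<k = below j<k
  ... | inj₂ refl = k∈l

mex-isMex : ∀ l → IsMex l (mex l)
mex-isMex l with mexAux-spec l (suc (length l)) 0 (λ ())
... | below , inj₁ missing = missing , below
... | below , inj₂ exhausted =
  contradiction (all-below⇒≤length l (suc (length l)) (below ∘ subst (_ <_) (sym exhausted)))
                1+n≰n

isMex-unique : ∀ {l m m'} → IsMex l m → IsMex l m' → m ≡ m'
isMex-unique {m = m} {m'} (m∉l , below) (m'∉l , below') with <-cmp m m'
... | tri< m<m' _ _ = contradiction (below' m<m') m∉l
... | tri≈ _ m≡m' _ = m≡m'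
... | tri> _ _ m'<m = contradiction (below m'<m) m'∉l

mex-++ : ∀ A B → mex B ∉ A → mex (A ++ B) ≡ mex B
mex-++ A B mex∉A = isMex-unique (mex-isMex (A ++ B))
  ( [ mex∉A , proj₁ (mex-isMex B) ] ∘ ∈-++⁻ A
  , λ j<mex → ∈-++⁺ʳ A (proj₂ (mex-isMex B) j<mex))

max-upper : ∀ {A : Set} (f : A → ℕ) {l a} → a ∈ l → f a ≤ foldr _⊔_ 0 (map f l)
max-upper f {b ∷ l} (Any.here refl) = m≤m⊔n (f b) _
max-upper f {b ∷ l} (Any.there a∈l) = ≤-trans (max-upper f a∈l) (m≤n⊔m (f b) _)

max-least : ∀ {A : Set} (f : A → ℕ) l {c} → (∀ {a} → a ∈ l → f a ≤ c) → foldr _⊔_ 0 (map f l) ≤ c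
max-least f [] bound = z≤n
max-least f (a ∷ l) bound = ⊔-lub (bound (Any.here refl)) (max-least f l (bound ∘ Any.there))

data Move : ∀ {n} → Subset n → Position n → Position n → Set where
  []   : Move [] [] []
  take : ∀ {n} {E : Subset n} {x x' a b} → b < a → Move E x x' → Move (true ∷ E) (a ∷ x) (b ∷ x')
  keep : ∀ {n} {E : Subset n} {x x' a} → Move E x x' → Move (false ∷ E) (a ∷ x) (a ∷ x')

move⇒edgeMove : ∀ {n} {E : Subset n} {x x'} → Move E x x' → x' ∈ edgeMoves E x
move⇒edgeMove [] = Any.here refl
move⇒edgeMove {E = true ∷ E} {a ∷ x} {b ∷ x'} (take b<a move) =
  ∈-concat⁺′ (∈-map⁺ (b ∷_) (move⇒edgeMove move))
             (∈-map⁺ (λ c → map (c ∷_) (edgeMoves E x)) (∈-upTo⁺ b<a))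
move⇒edgeMove (keep move) = ∈-map⁺ _ (move⇒edgeMove move)

edgeMove⇒move : ∀ {n} (E : Subset n) x {x'} → x' ∈ edgeMoves E x → Move E x x'
edgeMove⇒move [] [] (Any.here refl) = []
edgeMove⇒move (true ∷ E) (a ∷ x) x'∈
  with xs , x'∈xs , xs∈ ← ∈-concat⁻′ (map (λ c → map (c ∷_) (edgeMoves E x)) (upTo a)) x'∈
  with b , b∈ , refl ← ∈-map⁻ _ xs∈
  with x'' , x''∈ , refl ← ∈-map⁻ _ x'∈xs
  = take (∈-upTo⁻ b∈) (edgeMove⇒move E x x''∈)
edgeMove⇒move (false ∷ E) (a ∷ x) x'∈ with x'' , x''∈ , refl ← ∈-map⁻ _ x'∈ =
  keep (edgeMove⇒move E x x''∈)

option⇒move : ∀ {n} (ℋ : Family n) x {x'} → x' ∈ options ℋ x → ∃ λ E → E ∈ ℋ × Move E x x'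
option⇒move ℋ x x'∈
  with xs , x'∈xs , xs∈ ← ∈-concat⁻′ (map (λ E → edgeMoves E x) ℋ) x'∈
  with E , E∈ℋ , refl ← ∈-map⁻ _ xs∈
  = E , E∈ℋ , edgeMove⇒move E x x'∈xs

move⇒option : ∀ {n} (ℋ : Family n) {E x x'} → E ∈ ℋ → Move E x x' → x' ∈ options ℋ x
move⇒option ℋ {x = x} E∈ℋ move =
  ∈-concat⁺′ (move⇒edgeMove move) (∈-map⁺ (λ E → edgeMoves E x) E∈ℋ)

_≤ᵥ_ : ∀ {n} → Position n → Position n → Set
_≤ᵥ_ = Pointwise _≤_

shiftDown : ∀ {n} → ℕ → Position n → Position n
shiftDown k = Vec.map (_∸ k)

_≺_ : ∀ {n} → Position n → Position n → Set
x' ≺ x = sumV x' < sumV x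

≺-induction : ∀ {n} (P : Position n → Set) → (∀ x → (∀ {x'} → x' ≺ x → P x') → P x) → ∀ x → P x
≺-induction P = WF.All.wfRec (On.wellFounded sumV <-wellFounded) 0ℓ P

move-sum≤ : ∀ {n} {E : Subset n} {x x'} → Move E x x' → sumV x' ≤ sumV x
move-sum≤ [] = ≤-refl
move-sum≤ (take b<a move) = +-mono-≤ (<⇒≤ b<a) (move-sum≤ move)
move-sum≤ (keep move) = +-monoʳ-≤ _ (move-sum≤ move)

move-≺ : ∀ {n} {E : Subset n} {x x'} → Move E x x' → Nonempty E → x' ≺ x
move-≺ [] (() , _)
move-≺ (take b<a move) _ = +-mono-<-≤ b<a (move-sum≤ move)
move-≺ (keep {a = a} move) (_ , there i∈E) = +-monoʳ-< a (move-≺ move (_ , i∈E))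

move-≤ᵥ : ∀ {n} {E : Subset n} {x x'} → Move E x x' → x' ≤ᵥ x
move-≤ᵥ [] = []
move-≤ᵥ (take b<a move) = <⇒≤ b<a ∷ move-≤ᵥ move
move-≤ᵥ (keep move) = ≤-refl ∷ move-≤ᵥ move

move-lift : ∀ {n} {E : Subset n} {x x' y} → Move E x x' → x ≤ᵥ y → ∃ λ y' → Move E y y' × x' ≤ᵥ y'
move-lift [] [] = [] , [] , []
move-lift (take {b = b} b<a move) (a≤c ∷ x≤y) with y' , move' , x'≤y' ← move-lift move x≤y =
  b ∷ y' , take (<-≤-trans b<a a≤c) move' , ≤-refl ∷ x'≤y'
move-lift (keep move) (_∷_ {y = c} a≤c x≤y) with y' , move' , x'≤y' ← move-lift move x≤y =
  c ∷ y' , keep move' , a≤c ∷ x'≤y'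

-- An S-move from x is dominated by an H-move from x when H ⊆ S: the H-move
-- makes the same decreases on H and none outside.
move-dominated : ∀ {n} {H S : Subset n} {x x'} → H ⊆ S → Move S x x' → ∃ λ u → Move H x u × x' ≤ᵥ u
move-dominated {H = []} _ [] = [] , [] , []
move-dominated {H = true ∷ H} H⊆S (take {b = b} b<a move)
  with u , H-move , x'≤u ← move-dominated (drop-∷-⊆ H⊆S) move =
  b ∷ u , take b<a H-move , ≤-refl ∷ x'≤u
move-dominated {H = false ∷ H} H⊆S (take {a = a} b<a move)
  with u , H-move , x'≤u ← move-dominated (drop-∷-⊆ H⊆S) move =
  a ∷ u , keep H-move , <⇒≤ b<a ∷ x'≤u
move-dominated {H = true ∷ H} H⊆S (keep move) = contradiction (H⊆S here) λ ()
move-dominated {H = false ∷ H} H⊆S (keep {a = a} move)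
  with u , H-move , x'≤u ← move-dominated (drop-∷-⊆ H⊆S) move =
  a ∷ u , keep H-move , ≤-refl ∷ x'≤u

move-shift : ∀ {n} {E : Subset n} {x x'} k → Move E x x' → AllV (k ≤_) x' →
  Move E (shiftDown k x) (shiftDown k x')
move-shift k [] [] = []
move-shift k (take b<a move) (k≤b ∷ k≤x') = take (∸-monoˡ-< b<a k≤b) (move-shift k move k≤x')
move-shift k (keep move) (_ ∷ k≤x') = keep (move-shift k move k≤x')

minV-≤ : ∀ {n} (x : Position n) → AllV (minV x ≤_) x
minV-≤ [] = []
minV-≤ (a ∷ []) = ≤-refl ∷ []
minV-≤ (a ∷ b ∷ x) = m⊓n≤m a _ ∷ AllV.map (≤-trans (m⊓n≤n a _)) (minV-≤ (b ∷ x))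

minV-mono : ∀ {n} {x y : Position n} → x ≤ᵥ y → minV x ≤ minV y
minV-mono [] = z≤n
minV-mono (a≤b ∷ []) = a≤b
minV-mono (a≤b ∷ rest@(_ ∷ _)) = ⊓-mono-≤ a≤b (minV-mono rest)

AtLeastOn : ∀ {n} → Subset n → ℕ → Position n → Set
AtLeastOn [] k [] = ⊤
AtLeastOn (true ∷ E) k (a ∷ w) = k ≤ a × AtLeastOn E k w
AtLeastOn (false ∷ E) k (a ∷ w) = AtLeastOn E k w

all⇒atLeastOn : ∀ {n} (E : Subset n) {k w} → AllV (k ≤_) w → AtLeastOn E k w
all⇒atLeastOn [] [] = tt
all⇒atLeastOn (true ∷ E) (k≤a ∷ k≤w) = k≤a , all⇒atLeastOn E k≤w
all⇒atLeastOn (false ∷ E) (_ ∷ k≤w) = all⇒atLeastOn E k≤w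

atLeastOn-move : ∀ {n} (E : Subset n) {S k x x'} → S ⊆ ∁ E → Move S x x' →
  AtLeastOn E k x → AtLeastOn E k x'
atLeastOn-move [] _ [] _ = tt
atLeastOn-move (true ∷ E) S⊆∁E (take _ _) _ = contradiction (S⊆∁E here) λ ()
atLeastOn-move (true ∷ E) S⊆∁E (keep move) (k≤a , rest) = k≤a , atLeastOn-move E (drop-∷-⊆ S⊆∁E) move rest
atLeastOn-move (false ∷ E) S⊆∁E (take _ move) rest = atLeastOn-move E (drop-∷-⊆ S⊆∁E) move rest
atLeastOn-move (false ∷ E) S⊆∁E (keep move) rest = atLeastOn-move E (drop-∷-⊆ S⊆∁E) move rest

atLeastOn-shift : ∀ {n} (E : Subset n) {k} j (w : Position n) →
  AtLeastOn E k w → AtLeastOn E (k ∸ j) (shiftDown j w)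
atLeastOn-shift [] j [] _ = tt
atLeastOn-shift (true ∷ E) j (a ∷ w) (k≤a , rest) = ∸-monoˡ-≤ j k≤a , atLeastOn-shift E j w rest
atLeastOn-shift (false ∷ E) j (a ∷ w) rest = atLeastOn-shift E j w rest

atLeastOn-step : ∀ {n} (E : Subset n) {k} (w : Position n) →
  AtLeastOn E (suc k) w → ∃ λ w' → Move E w w' × AtLeastOn E k w'
atLeastOn-step [] [] _ = [] , [] , tt
atLeastOn-step (true ∷ E) (suc a ∷ w) (s≤s k≤a , rest) with w' , move , rest' ← atLeastOn-step E w rest =
  a ∷ w' , take ≤-refl move , k≤a , rest'
atLeastOn-step (false ∷ E) (a ∷ w) rest with w' , move , rest' ← atLeastOn-step E w rest =
  a ∷ w' , keep move , rest'

-- Throughout, ℋ has nonempty edges, so every play terminates and the fuelled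
-- definitions of grundy and height agree with their recursive descriptions.
module _ {n} (ℋ : Family n) (nonempty : All Nonempty ℋ) where

  option-≺ : ∀ {x x'} → x' ∈ options ℋ x → x' ≺ x
  option-≺ {x} x'∈ with E , E∈ℋ , move ← option⇒move ℋ x x'∈ = move-≺ move (All.lookup nonempty E∈ℋ)

  Local : (ℕ → Position n → ℕ) → Set
  Local F = ∀ k k' x → (∀ {x'} → x' ∈ options ℋ x → F k x' ≡ F k' x') → F (suc k) x ≡ F (suc k') x

  fuel-irrelevant : ∀ {F} → Local F → ∀ k k' x → sumV x < k → sumV x < k' → F k x ≡ F k' x
  fuel-irrelevant local (suc k) (suc k') x (s≤s x<k) (s≤s x<k') = local k k' x λ x'∈ →
    fuel-irrelevant local k k' _ (<-≤-trans (option-≺ x'∈) x<k) (<-≤-trans (option-≺ x'∈) x<k')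

  fuel-at-option : ∀ {F} → Local F → ∀ {x x'} → x' ∈ options ℋ x → F (sumV x) x' ≡ F (suc (sumV x')) x'
  fuel-at-option local x'∈ = fuel-irrelevant local _ _ _ (option-≺ x'∈) ≤-refl

  grundyF-local : Local (λ k → grundyF k ℋ)
  grundyF-local k k' x same = cong mex (map-cong-local (All.tabulate same))

  heightF-local : Local (λ k → heightF k ℋ)
  heightF-local k k' x same = cong (foldr _⊔_ 0) (map-cong-local (All.tabulate (cong suc ∘ same)))

  grundy-unfold : ∀ x → grundy ℋ x ≡ mex (map (grundy ℋ) (options ℋ x))
  grundy-unfold x = cong mex (map-cong-local (All.tabulate (fuel-at-option grundyF-local)))

  height-unfold : ∀ x → height ℋ x ≡ foldr _⊔_ 0 (map (λ x' → suc (height ℋ x')) (options ℋ x))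
  height-unfold x = cong (foldr _⊔_ 0)
    (map-cong-local (All.tabulate (cong suc ∘ fuel-at-option heightF-local)))

  height-option : ∀ {x x'} → x' ∈ options ℋ x → suc (height ℋ x') ≤ height ℋ x
  height-option {x} x'∈ = ≤-trans (max-upper (λ x' → suc (height ℋ x')) x'∈) (≤-reflexive (sym (height-unfold x)))

  height-lub : ∀ {x c} → (∀ {x'} → x' ∈ options ℋ x → suc (height ℋ x') ≤ c) → height ℋ x ≤ c
  height-lub {x} bound = ≤-trans (≤-reflexive (height-unfold x)) (max-least _ (options ℋ x) bound)

  height-move : ∀ {E x x'} → E ∈ ℋ → Move E x x' → suc (height ℋ x') ≤ height ℋ x
  height-move E∈ℋ = height-option ∘ move⇒option ℋ E∈ℋ

  -- Height is monotone: every play from x can be copied from a larger position.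
  height-mono : ∀ {x y} → x ≤ᵥ y → height ℋ x ≤ height ℋ y
  height-mono {x} = ≺-induction (λ x → ∀ {y} → x ≤ᵥ y → height ℋ x ≤ height ℋ y) step x
    where
    step : ∀ x → (∀ {x'} → x' ≺ x → ∀ {y} → x' ≤ᵥ y → height ℋ x' ≤ height ℋ y) →
           ∀ {y} → x ≤ᵥ y → height ℋ x ≤ height ℋ y
    step x ih {y} x≤y = height-lub λ {x'} x'∈ →
      let E , E∈ℋ , move = option⇒move ℋ x x'∈
          y' , move' , x'≤y' = move-lift move x≤y
      in ≤-trans (s≤s (ih (option-≺ x'∈) x'≤y')) (height-move E∈ℋ move')

  -- If E ∈ ℋ and all coordinates on E are ≥ k, then k E-moves can be played.
  height-atLeastOn : ∀ {E} → E ∈ ℋ → ∀ k w → AtLeastOn E k w → k ≤ height ℋ w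
  height-atLeastOn E∈ℋ zero w _ = z≤n
  height-atLeastOn {E} E∈ℋ (suc k) w bound with w' , move , bound' ← atLeastOn-step E w bound =
    ≤-trans (s≤s (height-atLeastOn E∈ℋ k w' bound')) (height-move E∈ℋ move)

-- C(a + 1, 2): the threshold in f when y = a + 1.
tri : ℕ → ℕ
tri a = suc a C 2

wrapped : ℕ → ℕ → ℕ
wrapped a m = tri a + ((m ∸ tri a ∸ 1) % suc a)

fFormula : ℕ → ℕ → ℕ → ℕ
fFormula m a h = if m ≤ᵇ tri a then h else wrapped a m

fFormula-low : ∀ {m} a h → m ≤ tri a → fFormula m a h ≡ h
fFormula-low {m} a h m≤tri with m ≤ᵇ tri a | ≤⇒≤ᵇ m≤tri
... | true | _ = refl

fFormula-high : ∀ {m} a h → tri a < m → fFormula m a h ≡ wrapped a m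
fFormula-high {m} a h tri<m with m ≤ᵇ tri a in test
... | false = refl
... | true = contradiction (≤ᵇ⇒≤ m (tri a) (subst T (sym test) tt)) (<⇒≱ tri<m)

tri-suc : ∀ a → tri (suc a) ≡ suc a + tri a
tri-suc a = trans (sym (nCk+nC[k+1]≡[n+1]C[k+1] (suc a) 1)) (cong (_+ tri a) (nC1≡n (suc a)))

-- The ranges [tri a, tri a + a] of wrapped values are disjoint for distinct a.
tri-gap : ∀ {a' a} → a' < a → tri a' + suc a' ≤ tri a
tri-gap {a'} {suc a} (s≤s a'≤a) with m≤n⇒m<n∨m≡n a'≤a
... | inj₂ refl = ≤-reflexive (trans (+-comm (tri a') (suc a')) (sym (tri-suc a')))
... | inj₁ a'<a = ≤-trans (tri-gap a'<a) (≤-trans (m≤n+m (tri a) (suc a)) (≤-reflexive (sym (tri-suc a))))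

wrapped-< : ∀ a m → wrapped a m < tri a + suc a
wrapped-< a m = +-monoʳ-< (tri a) (m%n<n (m ∸ tri a ∸ 1) (suc a))

wrapped-<-m : ∀ a {m} → tri a < m → wrapped a m < m
wrapped-<-m a {m} tri<m = begin-strict
    tri a + ((m ∸ tri a ∸ 1) % suc a) ≤⟨ +-monoʳ-≤ (tri a) (m%n≤m (m ∸ tri a ∸ 1) (suc a)) ⟩
    tri a + (m ∸ tri a ∸ 1)           ≡⟨ cong (tri a +_) (trans (∸-+-assoc m (tri a) 1) (cong (m ∸_) (+-comm (tri a) 1))) ⟩
    tri a + (m ∸ suc (tri a))         <⟨ n<1+n _ ⟩
    suc (tri a) + (m ∸ suc (tri a))   ≡⟨ m+[n∸m]≡n tri<m ⟩
    m                                 ∎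
  where open ≤-Reasoning

%-shift-≢ : ∀ p d y .{{_ : NonZero y}} → 0 < d → d < y → (p + d) % y ≢ p % y
%-shift-≢ p d y 0<d d<y same = shifted-residue r (m%n<n p y) (begin
    (r + d) % y         ≡⟨ cong (λ t → (r + t) % y) (sym (m<n⇒m%n≡m d<y)) ⟩
    (r + d % y) % y     ≡⟨ sym (%-distribˡ-+ p d y) ⟩
    (p + d) % y         ≡⟨ same ⟩
    r                   ∎)
  where
  open ≡-Reasoning
  r = p % y
  shifted-residue : ∀ r → r < y → (r + d) % y ≢ r
  shifted-residue r r<y with r + d <? y
  ... | yes r+d<y = λ eq → <⇒≢ (m<m+n r 0<d) (sym (trans (sym (m<n⇒m%n≡m r+d<y)) eq))
  ... | no r+d≮y = λ eq → <⇒≢ r+d∸y<r (trans (sym wraps) eq)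
    where
    y≤r+d : y ≤ r + d
    y≤r+d = ≮⇒≥ r+d≮y
    r+d∸y<y : r + d ∸ y < y
    r+d∸y<y = subst (r + d ∸ y <_) (m+n∸n≡m y y) (∸-monoˡ-< (+-mono-< r<y d<y) y≤r+d)
    r+d∸y<r : r + d ∸ y < r
    r+d∸y<r = subst (r + d ∸ y <_) (m+n∸n≡m r y) (∸-monoˡ-< (+-monoʳ-< r d<y) y≤r+d)
    wraps : (r + d) % y ≡ r + d ∸ y
    wraps = trans (sym (m≤n⇒[n∸m]%m≡n%m y≤r+d)) (m<n⇒m%n≡m r+d∸y<y)

-- Above the threshold, f separates the two positions: for different a the
-- values lie in disjoint blocks, for equal a the residues differ by m - m'.
wrapped-separates : ∀ {m a m' a'} → tri a' < m' → m' ≤ m → (m' ≡ m → a' < a) → m ∸ m' ≤ a' →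
  wrapped a' m' ≢ wrapped a m
wrapped-separates {m} {a} {m'} {a'} tri<m' m'≤m same-min gap with <-cmp a' a
... | tri< a'<a _ _ = <⇒≢ (<-≤-trans (wrapped-< a' m') (≤-trans (tri-gap a'<a) (m≤m+n (tri a) _)))
... | tri> _ _ a<a' = ≢-sym (<⇒≢ (<-≤-trans (wrapped-< a m) (≤-trans (tri-gap a<a') (m≤m+n (tri a') _))))
... | tri≈ _ refl _ = λ eq → %-shift-≢ p d (suc a) 0<d (s≤s gap)
        (sym (+-cancelˡ-≡ (tri a) _ _ (trans eq (cong (λ t → tri a + t % suc a) split))))
  where
  d = m ∸ m'
  p = m' ∸ tri a ∸ 1
  0<d : 0 < d
  0<d = m<n⇒0<n∸m (≤∧≢⇒< m'≤m (λ m'≡m → <-irrefl refl (same-min m'≡m)))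
  split : m ∸ tri a ∸ 1 ≡ p + d
  split = begin
    m ∸ tri a ∸ 1          ≡⟨ cong (λ t → t ∸ tri a ∸ 1) (sym (m+[n∸m]≡n m'≤m)) ⟩
    (m' + d) ∸ tri a ∸ 1   ≡⟨ cong (_∸ 1) (+-∸-comm d (<⇒≤ tri<m')) ⟩
    (m' ∸ tri a + d) ∸ 1   ≡⟨ +-∸-comm d (m<n⇒0<n∸m tri<m') ⟩
    p + d                  ∎
    where open ≡-Reasoning

fFormula-separates : ∀ {m a h m' a' h'} → h' < h → m' ≤ m → (m' ≡ m → a' < a) → m ∸ m' ≤ a' → m ≤ h' →
  fFormula m' a' h' ≢ fFormula m a h
fFormula-separates {m} {a} {h} {m'} {a'} {h'} h'<h m'≤m same-min gap m≤h'
  with m ≤? tri a | m' ≤? tri a'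
... | yes low | yes low' = λ eq →
  <⇒≢ h'<h (trans (sym (fFormula-low a' h' low')) (trans eq (fFormula-low a h low)))
... | yes low | no high' = λ eq →
  <⇒≢ (<-≤-trans (wrapped-<-m a' (≰⇒> high')) (≤-trans m'≤m (≤-trans m≤h' (<⇒≤ h'<h))))
      (trans (sym (fFormula-high a' h' (≰⇒> high'))) (trans eq (fFormula-low a h low)))
... | no high | yes low' = λ eq →
  <⇒≢ (<-≤-trans (wrapped-<-m a (≰⇒> high)) m≤h')
      (trans (sym (fFormula-high a h (≰⇒> high))) (trans (sym eq) (fFormula-low a' h' low')))
... | no high | no high' = λ eq →
  wrapped-separates (≰⇒> high') m'≤m same-min gap
      (trans (sym (fFormula-high a' h' (≰⇒> high'))) (trans eq (fFormula-high a h (≰⇒> high))))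

hypergraph-∷ : ∀ {n} {ℋ : Family n} {S} → IsHypergraph ℋ → Nonempty S → IsHypergraph (S ∷ ℋ)
hypergraph-∷ (_ , nonempty , covers) S-nonempty = (λ ()) , S-nonempty ∷ nonempty , Any.there ∘ covers

module Extension {n} (ℋ : Family n) {H H' S : Subset n} (nonempty : All Nonempty ℋ)
                 (H∈ℋ : H ∈ ℋ) (H'∈ℋ : H' ∈ ℋ) (H⊆S : H ⊆ S) (S⊆∁H' : S ⊆ ∁ H') where

  S-nonempty : Nonempty S
  S-nonempty = let i , i∈H = All.lookup nonempty H∈ℋ in i , H⊆S i∈H

  nonempty⁺ : All Nonempty (S ∷ ℋ)
  nonempty⁺ = S-nonempty ∷ nonempty

  -- An S-move lowers the ℋ-height, because it is dominated by an H-move.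
  S-move-height : ∀ {x x'} → Move S x x' → suc (height ℋ x') ≤ height ℋ x
  S-move-height move with u , H-move , x'≤u ← move-dominated H⊆S move =
    ≤-trans (s≤s (height-mono ℋ nonempty x'≤u)) (height-move ℋ nonempty H∈ℋ H-move)

  height-S : ∀ x → height (S ∷ ℋ) x ≡ height ℋ x
  height-S = ≺-induction _ λ x ih →
    let ih⁺ : ∀ {x'} → x' ∈ options (S ∷ ℋ) x → height (S ∷ ℋ) x' ≡ height ℋ x'
        ih⁺ = ih ∘ option-≺ (S ∷ ℋ) nonempty⁺
        bound : ∀ {x'} → x' ∈ options (S ∷ ℋ) x → suc (height ℋ x') ≤ height ℋ x
        bound x'∈ = [ S-move-height ∘ edgeMove⇒move S x , height-option ℋ nonempty ] (∈-++⁻ (edgeMoves S x) x'∈)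
    in ≤-antisym
      (height-lub (S ∷ ℋ) nonempty⁺ λ x'∈ → ≤-trans (≤-reflexive (cong suc (ih⁺ x'∈))) (bound x'∈))
      (height-lub ℋ nonempty λ x'∈ →
        let x'∈⁺ = ∈-++⁺ʳ (edgeMoves S x) x'∈
        in ≤-trans (≤-reflexive (cong suc (sym (ih⁺ x'∈⁺)))) (height-option (S ∷ ℋ) nonempty⁺ x'∈⁺))

  f-S : ∀ x → fH (S ∷ ℋ) x ≡ fH ℋ x
  f-S x = cong₂ (fFormula (minV x)) (height-S (shiftDown (minV x) x)) (height-S x)

  module _ (jm : ∀ x → grundy ℋ x ≡ fH ℋ x) where

    S-move-changes-grundy : ∀ {x x'} → Move S x x' → grundy ℋ x' ≢ grundy ℋ x
    S-move-changes-grundy {x} {x'} move same =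
      fFormula-separates h'<h m'≤m same-min gap m≤h' (trans (sym (jm x')) (trans same (jm x)))
      where
      m = minV x
      m' = minV x'
      a = height ℋ (shiftDown m x)
      h'<h : height ℋ x' < height ℋ x
      h'<h = S-move-height move
      m'≤m : m' ≤ m
      m'≤m = minV-mono (move-≤ᵥ move)
      -- S misses H', so x' keeps the coordinates of x on H', all ≥ m.
      x'-on-H' : AtLeastOn H' m x'
      x'-on-H' = atLeastOn-move H' S⊆∁H' move (all⇒atLeastOn H' (minV-≤ x))
      m≤h' : m ≤ height ℋ x'
      m≤h' = height-atLeastOn ℋ nonempty H'∈ℋ m x' x'-on-H'
      gap : m ∸ m' ≤ height ℋ (shiftDown m' x')
      gap = height-atLeastOn ℋ nonempty H'∈ℋ (m ∸ m') _ (atLeastOn-shift H' m' x' x'-on-H')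
      -- with equal minima the move translates to a move between the shifted positions
      same-min : m' ≡ m → height ℋ (shiftDown m' x') < a
      same-min m'≡m = subst (λ k → height ℋ (shiftDown k x') < a) (sym m'≡m)
        (S-move-height (move-shift m move (subst (λ k → AllV (k ≤_) x') m'≡m (minV-≤ x'))))

    -- Hence the additional S-options never hit the mex, and Grundy values agree.
    grundy-S : ∀ x → grundy (S ∷ ℋ) x ≡ grundy ℋ x
    grundy-S = ≺-induction _ step
      where
      step : ∀ x → (∀ {x'} → x' ≺ x → grundy (S ∷ ℋ) x' ≡ grundy ℋ x') → grundy (S ∷ ℋ) x ≡ grundy ℋ x
      step x ih = begin
        grundy (S ∷ ℋ) x                             ≡⟨ grundy-unfold (S ∷ ℋ) nonempty⁺ x ⟩
        mex (map (grundy (S ∷ ℋ)) (A ++ B))          ≡⟨ cong mex (map-cong-local (All.tabulate (ih ∘ option-≺ (S ∷ ℋ) nonempty⁺))) ⟩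
        mex (map (grundy ℋ) (A ++ B))                ≡⟨ cong mex (map-++ (grundy ℋ) A B) ⟩
        mex (map (grundy ℋ) A ++ map (grundy ℋ) B)   ≡⟨ mex-++ _ _ avoids ⟩
        mex (map (grundy ℋ) B)                       ≡⟨ grundy-unfold ℋ nonempty x ⟨
        grundy ℋ x                                   ∎
        where
        open ≡-Reasoning
        A = edgeMoves S x
        B = options ℋ x
        avoids : mex (map (grundy ℋ) B) ∉ map (grundy ℋ) A
        avoids hit with x' , x'∈A , eq ← ∈-map⁻ (grundy ℋ) hit =
          S-move-changes-grundy (edgeMove⇒move S x x'∈A) (sym (trans (grundy-unfold ℋ nonempty x) eq))

theorem3p7 : ∀ {n} (ℋ : Family n) (H H' S : Subset n) →
    JM ℋ → H ∈ ℋ → H' ∈ ℋ → H ∩ H' ≡ ⊥ → H ⊆ S → S ⊆ ∁ H' →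
    JM (S ∷ ℋ) × (∀ x → grundy (S ∷ ℋ) x ≡ grundy ℋ x)
theorem3p7 ℋ H H' S (hypergraph , jm) H∈ℋ H'∈ℋ _ H⊆S S⊆∁H' =
  (hypergraph-∷ hypergraph S-nonempty , jm⁺) , grundy-S jm
  where
  open Extension ℋ (proj₁ (proj₂ hypergraph)) H∈ℋ H'∈ℋ H⊆S S⊆∁H'
  open ≡-Reasoning
  jm⁺ : ∀ x → grundy (S ∷ ℋ) x ≡ fH (S ∷ ℋ) x
  jm⁺ x = begin
    grundy (S ∷ ℋ) x  ≡⟨ grundy-S jm x ⟩
    grundy ℋ x        ≡⟨ jm x ⟩
    fH ℋ x            ≡⟨ f-S x ⟨
    fH (S ∷ ℋ) x      ∎
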